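{- In LP$^{\mathrm{MLN}}$ (i.e. with respect to semi-strong equivalence $\equiv_{s,s}$): the S-RD-1 transformation is neither SE-preserving nor NSE-preserving; and the S-RD-2 transformation is SE-preserving but not NSE-preserving.
   Context: Atoms are propositional. A rule $r$ is an expression $h_1\vee\cdots\vee h_k\leftarrow b_1,\dots,b_m,\mathit{not}\,c_1,\dots,\mathit{not}\,c_n$; write $H(r)$, $B^+(r)$, $B^-(r)$ for the sets of head, positive body and negative body atoms. A program is a finite set of rules. An interpretation $X$ satisfies $r$ iff $X\cap H(r)\neq\emptyset$ or $B^+(r)\not\subseteq X$ or $B^-(r)\cap X\neq\emptyset$. GL-reduct $P^X=\{H(r)\leftarrow B^+(r) : r\in P,\ B^-(r)\cap X=\emptyset\}$; $X$ is an ASP stable model of $P$ iff $X\models P^X$ and no proper subset of $X$ satisfies $P^X$. Weights of LP$^{\mathrm{MLN}}$ rules are omitted; $X$ is an LP$^{\mathrm{MLN}}$ stable model of $P$ iff $X$ is an ASP stable model of $\{r\in P: X\models r\}$. $P\equiv_{s,s}Q$ iff for every program $R$, $P\cup R$ and $Q\cup R$ have the same LP$^{\mathrm{MLN}}$ stable models. Programs are regarded as tuples of rules; $\langle P,Q\rangle$ is the concatenation. For a tuple $T=\langle r_1,\dots,r_n\rangle$ let $\langle S_1,\dots,S_{3n}\rangle=\langle H(r_1),B^+(r_1),B^-(r_1),\dots,H(r_n),B^+(r_n),B^-(r_n)\rangle$; for nonempty $N'\subseteq\{1,\dots,3n\}$ the independent set is $I_{N'}=\bigcap_{i\in N'}S_i\setminus\bigcup_{j\notin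 N'}S_j$. For $i\in\{1,2\}$, the S-RD-$i$ transformation deletes some atom $a\in I$ from an independent set $I$ with $|I|=i$, i.e. removes $a$ from every rule of $T$. For a pair $T=\langle P,Q\rangle$ the result is $\langle P^\circ,Q^\circ\rangle$ with $P^\circ$ the first $|P|$ rules. A transformation type is SE-preserving if for every pair $\langle P,Q\rangle$ and every admissible application $P\equiv_{s,s}Q$ implies $P^\circ\equiv_{s,s}Q^\circ$, and NSE-preserving if $P\not\equiv_{s,s}Q$ implies $P^\circ\not\equiv_{s,s}Q^\circ$. -}

module Defs where

open import Data.Nat using (ℕ; _≡ᵇ_)
open import Data.Bool using (Bool; true; false; not; _∧_; _∨_)
open import Data.List using (List; []; _∷_; _++_; map; filterᵇ; length; lookup; concatMap)
open import Data.Bool.ListAction using (any; all)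
open import Data.List.Membership.Propositional using (_∈_; _∉_)
open import Data.List.Relation.Unary.Unique.Propositional using (Unique)
open import Data.Fin using (Fin)
open import Data.Fin.Subset using (Subset; Nonempty) renaming (_∈_ to _∈ₛ_; _∉_ to _∉ₛ_)
open import Data.Product using (Σ; _×_; ∃; ∃-syntax)
open import Relation.Binary.PropositionalEquality using (_≡_; _≢_)
open import Relation.Nullary using (¬_)
open import Function.Bundles using (_⇔_)

Atom : Set
Atom = ℕ

-- A rule  h1 ∨ ... ∨ hk ← b1,...,bm, not c1,...,not cn
record Rule : Set where
  constructor rule
  field
    H  : List Atom
    B⁺ : List Atom
    B⁻ : List Atom
open Rule public

-- Programs as tuples (lists) of rules; P ∪ R is concatenation.
Program : Set
Program = List Rule

Interp : Set
Interp = Atom → Bool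

sat : Interp → Rule → Bool
sat X r = any X (H r) ∨ not (all X (B⁺ r)) ∨ any X (B⁻ r)

satProg : Interp → Program → Bool
satProg X P = all (sat X) P

reduct : Program → Interp → Program
reduct P X = map (λ r → rule (H r) (B⁺ r) []) (filterᵇ (λ r → not (any X (B⁻ r))) P)

_⊂_ : Interp → Interp → Set
Y ⊂ X = (∀ a → Y a ≡ true → X a ≡ true) × (∃[ a ] (X a ≡ true × Y a ≡ false))

ASPStable : Program → Interp → Set
ASPStable P X = satProg X (reduct P X) ≡ true
              × (∀ Y → Y ⊂ X → satProg Y (reduct P X) ≡ false)

LPMLNStable : Program → Interp → Set
LPMLNStable P X = ASPStable (filterᵇ (sat X) P) X

_≡ss_ : Program → Program → Set
P ≡ss Q = ∀ (R : Program) (X : Interp) → LPMLNStable (P ++ R) X ⇔ LPMLNStable (Q ++ R) X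

sets : Program → List (List Atom)
sets T = concatMap (λ r → H r ∷ B⁺ r ∷ B⁻ r ∷ []) T

InIndep : (T : Program) → Subset (length (sets T)) → Atom → Set
InIndep T N' a = ∀ (i : Fin (length (sets T)))
  → (i ∈ₛ N' → a ∈ lookup (sets T) i) × (i ∉ₛ N' → a ∉ lookup (sets T) i)

HasCard : (Atom → Set) → ℕ → Set
HasCard I k = Σ (List Atom) λ xs → Unique xs × (∀ a → I a ⇔ (a ∈ xs)) × length xs ≡ k

delRule : Atom → Rule → Rule
delRule a r = rule (del (H r)) (del (B⁺ r)) (del (B⁻ r))
  where del : List Atom → List Atom
        del = filterᵇ (λ b → not (b ≡ᵇ a))

delProg : Atom → Program → Program
delProg a = map (delRule a)

-- admissible S-RD-i application to ⟨P,Q⟩ : delete atom a from an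
-- independent set I_{N'} of ⟨P,Q⟩ (N' nonempty) with |I_{N'}| = i
AdmissibleSRD : ℕ → Program → Program → Atom → Set
AdmissibleSRD i P Q a =
  Σ (Subset (length (sets (P ++ Q)))) λ N' →
    Nonempty N' × InIndep (P ++ Q) N' a × HasCard (InIndep (P ++ Q) N') i

SEPreserving-SRD : ℕ → Set
SEPreserving-SRD i = ∀ (P Q : Program) (a : Atom) → AdmissibleSRD i P Q a
  → P ≡ss Q → delProg a P ≡ss delProg a Q

NSEPreserving-SRD : ℕ → Set
NSEPreserving-SRD i = ∀ (P Q : Program) (a : Atom) → AdmissibleSRD i P Q a
  → ¬ (P ≡ss Q) → ¬ (delProg a P ≡ss delProg a Q)

module Submission where

-- Semi-strong equivalence has a semantic characterisation: P ≡ss Q iff for all Y ⊆ X,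
-- Y ⊨ (P_X)^X ⇔ Y ⊨ (Q_X)^X, where P_X is the set of rules of P satisfied by X.
-- Sufficiency is a computation with the reduct.  For necessity, a pair (X, Y)
-- separating P from Q is restricted to the atoms of P and Q and the program R
-- consisting of the facts of Y and of all rules c ← d with c, d ∈ X ∖ Y is added;
-- then X is an LPMLN stable model of Q ∪ R but not of P ∪ R.
--
-- If {a, b} is an independent set then b occurs in every body or head containing a,
-- so deleting a has the same effect on satisfaction as giving a the truth value of b;
-- the characterisation then carries P ≡ss Q over to the reduced programs.
-- The three negative claims are refuted by small programs.

open import Defs
open import Data.Bool using (Bool; true; false; not; _∧_; _∨_; T; T?)
open import Data.Bool.Properties
  using (T-≡; not-injective; ∧-assoc; ∧-zeroʳ; ∧-identityʳ; ∨-zeroʳ; ∨-identityʳ)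
  renaming (_≟_ to _≟ᵇ_)
open import Data.Bool.ListAction using (any; all; or; and)
open import Data.Empty using (⊥-elim)
open import Data.Fin using (#_)
import Data.Fin.Properties as Fin
open import Data.Fin.Subset using (⁅_⁆; _∪_)
open import Data.Fin.Subset.Properties using () renaming (_∈?_ to _∈ₛ?_)
open import Data.List
  using (List; []; _∷_; _++_; map; length; lookup; filterᵇ; concat; concatMap; cartesianProductWith)
open import Data.List.Properties using (map-cong-local; map-∘; map-++; concat-++)
open import Data.List.Relation.Binary.Subset.Propositional using (_⊆_)
open import Data.List.Relation.Binary.Subset.Propositional.Properties using (any⁺)
open import Data.List.Relation.Unary.All as All using (All)
open import Data.List.Relation.Unary.All.Properties using (all⁺; all⁻; all-anti-mono; anti-mono; ++⁻)
import Data.List.Relation.Unary.AllPairs as AllPairs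
open import Data.List.Relation.Unary.Any using (Any; here; there; any?; satisfied; index)
open import Data.List.Relation.Unary.Any.Properties using (lookup-index) renaming (any⁺ to any-lose)
open import Data.List.Membership.Propositional using (_∈_; lose)
open import Data.List.Membership.Propositional.Properties
  using ( ∈-filter⁺; ∈-filter⁻; ∈-map⁺; ∈-map⁻; ∈-++⁺ˡ; ∈-++⁺ʳ; ∈-++⁻
        ; ∈-cartesianProductWith⁺; ∈-cartesianProductWith⁻)
open import Data.Nat using (suc; _≟_; _≡ᵇ_)
open import Data.List.Membership.DecPropositional _≟_ using (_∈?_)
open import Data.List.Relation.Unary.Unique.DecPropositional _≟_ using (unique?)
open import Data.Product using (_×_; _,_; proj₁; proj₂; ∃-syntax)
open import Data.Sum using (inj₁; inj₂)
open import Function using (_∘_; case_of_)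
open import Function.Bundles using (_⇔_; mk⇔; Equivalence)
open import Function.Properties.Equivalence using () renaming (sym to ⇔-sym; refl to ⇔-refl)
open import Relation.Nullary using (¬_; Dec; yes; no; does; contradiction; _×-dec_; _→-dec_; ¬?)
open import Relation.Nullary.Decidable using (dec-true; dec-false; True; toWitness)
open import Relation.Binary.PropositionalEquality
open ≡-Reasoning

T-ext : ∀ {a b} → (T a → T b) → (T b → T a) → a ≡ b
T-ext {true}  {true}  _   _   = refl
T-ext {false} {false} _   _   = refl
T-ext {true}  {false} a⇒b _   = ⊥-elim (a⇒b _)
T-ext {false} {true}  _   b⇒a = ⊥-elim (b⇒a _)

false-agreement⇒≡ : ∀ {a b} → (a ≡ false → b ≡ false) → (b ≡ false → a ≡ false) → a ≡ b
false-agreement⇒≡ {true}  {true}  _   _   = refl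
false-agreement⇒≡ {false} {false} _   _   = refl
false-agreement⇒≡ {true}  {false} _   b⇒a = b⇒a refl
false-agreement⇒≡ {false} {true}  a⇒b _   = sym (a⇒b refl)

∧-not-elim : ∀ {a b} → (a ∧ not b) ≡ true → a ≡ true × b ≡ false
∧-not-elim {true} {false} _ = refl , refl

∨-not-elim : ∀ {a b} → (a ∨ not b) ≡ true → b ≡ true → a ≡ true
∨-not-elim {true}          _  _  = refl
∨-not-elim {false} {true}  () _
∨-not-elim {false} {false} _  ()

module _ {A : Set} {p : A → Bool} where

  all-∈ : ∀ {xs x} → all p xs ≡ true → x ∈ xs → p x ≡ true
  all-∈ {xs} h x∈xs = Equivalence.to T-≡ (All.lookup (all⁺ p xs (Equivalence.from T-≡ h)) x∈xs)

  ∈-all : ∀ {xs} → (∀ {x} → x ∈ xs → p x ≡ true) → all p xs ≡ true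
  ∈-all h = Equivalence.to T-≡ (all⁻ p (All.tabulate (Equivalence.from T-≡ ∘ h)))

  all-∉ : ∀ {xs x} → x ∈ xs → p x ≡ false → all p xs ≡ false
  all-∉ {xs} x∈xs px with all p xs in h
  ... | false = refl
  ... | true  = trans (sym (all-∈ h x∈xs)) px

  any-∈ : ∀ {xs x} → x ∈ xs → p x ≡ true → any p xs ≡ true
  any-∈ x∈xs px = Equivalence.to T-≡ (any-lose p (lose x∈xs (Equivalence.from T-≡ px)))

  all-++ : ∀ xs ys → all p (xs ++ ys) ≡ all p xs ∧ all p ys
  all-++ []       ys = refl
  all-++ (x ∷ xs) ys = trans (cong (p x ∧_) (all-++ xs ys)) (sym (∧-assoc (p x) _ _))

  any-≋ : ∀ {xs ys} → xs ⊆ ys → ys ⊆ xs → any p xs ≡ any p ys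
  any-≋ xs⊆ys ys⊆xs = T-ext (any⁺ p xs⊆ys) (any⁺ p ys⊆xs)

  all-≋ : ∀ {xs ys} → xs ⊆ ys → ys ⊆ xs → all p xs ≡ all p ys
  all-≋ xs⊆ys ys⊆xs = T-ext (all-anti-mono p ys⊆xs) (all-anti-mono p xs⊆ys)

  ∈-filterᵇ⁻ : ∀ {xs x} → x ∈ filterᵇ p xs → x ∈ xs × p x ≡ true
  ∈-filterᵇ⁻ x∈ with ∈-filter⁻ (T? ∘ p) x∈
  ... | x∈xs , px = x∈xs , Equivalence.to T-≡ px

  ∈-filterᵇ⁺ : ∀ {xs x} → x ∈ xs → p x ≡ true → x ∈ filterᵇ p xs
  ∈-filterᵇ⁺ x∈xs px = ∈-filter⁺ (T? ∘ p) x∈xs (Equivalence.from T-≡ px)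

-- SS-models

_⊑_ : Interp → Interp → Set
Y ⊑ X = ∀ a → Y a ≡ true → X a ≡ true

positivePart : Rule → Rule
positivePart r = rule (H r) (B⁺ r) []

-- ssModel P X Y = true  iff  Y ⊨ (P_X)^X.
ssRule : Interp → Interp → Rule → Bool
ssRule X Y r = not (sat X r) ∨ any X (B⁻ r) ∨ sat Y (positivePart r)

ssModel : Program → Interp → Interp → Bool
ssModel P X Y = all (ssRule X Y) P

SameSSModels : Program → Program → Set
SameSSModels P Q = ∀ X Y → Y ⊑ X → ssModel P X Y ≡ ssModel Q X Y

reduct-ssModel : ∀ X Y P → satProg Y (reduct (filterᵇ (sat X) P) X) ≡ ssModel P X Y
reduct-ssModel X Y []      = refl
reduct-ssModel X Y (r ∷ P) with sat X r
... | false = reduct-ssModel X Y P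
... | true with any X (B⁻ r)
...   | true  = reduct-ssModel X Y P
...   | false = cong (sat Y (positivePart r) ∧_) (reduct-ssModel X Y P)

ssModel-++ : ∀ P R X Y → ssModel (P ++ R) X Y ≡ ssModel P X Y ∧ ssModel R X Y
ssModel-++ P R X Y = all-++ P R

ssRule-refl : ∀ X r → ssRule X X r ≡ true
ssRule-refl X r with any X (H r) | all X (B⁺ r) | any X (B⁻ r)
... | true  | _     | n     = ∨-zeroʳ n
... | false | false | n     = ∨-zeroʳ n
... | false | true  | true  = refl
... | false | true  | false = refl

ssModel-refl : ∀ P X → ssModel P X X ≡ true
ssModel-refl P X = ∈-all {xs = P} λ {r} _ → ssRule-refl X r

sat-tautology : ∀ Y r {c} → c ∈ H r → c ∈ B⁺ r → sat Y r ≡ true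
sat-tautology Y r {c} c∈H c∈B⁺ with Y c in Yc
... | true  rewrite any-∈ {p = Y} c∈H Yc  = refl
... | false rewrite all-∉ {p = Y} c∈B⁺ Yc = ∨-zeroʳ (any Y (H r))

ssRule-tautology : ∀ X Y r {c} → c ∈ H r → c ∈ B⁺ r → ssRule X Y r ≡ true
ssRule-tautology X Y r c∈H c∈B⁺ rewrite sat-tautology Y (positivePart r) c∈H c∈B⁺
                                      | ∨-zeroʳ (any X (B⁻ r)) = ∨-zeroʳ (not (sat X r))

LPMLNStable⇔minimal : ∀ P X → LPMLNStable P X ⇔ (∀ Y → Y ⊂ X → ssModel P X Y ≡ false)
LPMLNStable⇔minimal P X = mk⇔
  (λ (_ , minimal) Y Y⊂X → trans (sym (reduct-ssModel X Y P)) (minimal Y Y⊂X))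
  (λ minimal → trans (reduct-ssModel X X P) (ssModel-refl P X)
             , λ Y Y⊂X → trans (reduct-ssModel X Y P) (minimal Y Y⊂X))

SameSSModels-sym : ∀ P Q → SameSSModels P Q → SameSSModels Q P
SameSSModels-sym P Q same X Y Y⊑X = sym (same X Y Y⊑X)

SameSSModels-++ʳ : ∀ P Q R → SameSSModels P Q → SameSSModels (P ++ R) (Q ++ R)
SameSSModels-++ʳ P Q R same X Y Y⊑X = begin
  ssModel (P ++ R) X Y            ≡⟨ ssModel-++ P R X Y ⟩
  ssModel P X Y ∧ ssModel R X Y   ≡⟨ cong (_∧ ssModel R X Y) (same X Y Y⊑X) ⟩
  ssModel Q X Y ∧ ssModel R X Y   ≡⟨ ssModel-++ Q R X Y ⟨
  ssModel (Q ++ R) X Y            ∎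

LPMLNStable-transfer : ∀ P Q X → SameSSModels P Q → LPMLNStable P X → LPMLNStable Q X
LPMLNStable-transfer P Q X same stable = Equivalence.from (LPMLNStable⇔minimal Q X) λ Y Y⊂X →
  trans (sym (same X Y (proj₁ Y⊂X))) (Equivalence.to (LPMLNStable⇔minimal P X) stable Y Y⊂X)

SameSSModels⇒≡ss : ∀ P Q → SameSSModels P Q → P ≡ss Q
SameSSModels⇒≡ss P Q same R X = mk⇔
  (LPMLNStable-transfer (P ++ R) (Q ++ R) X (SameSSModels-++ʳ P Q R same))
  (LPMLNStable-transfer (Q ++ R) (P ++ R) X (SameSSModels-++ʳ Q P R (SameSSModels-sym P Q same)))

AgreeOn : List Atom → Interp → Interp → Set
AgreeOn ℓ X X′ = All (λ c → X c ≡ X′ c) ℓ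

any-local : ∀ {ℓ X X′} → AgreeOn ℓ X X′ → any X ℓ ≡ any X′ ℓ
any-local = cong or ∘ map-cong-local

all-local : ∀ {ℓ X X′} → AgreeOn ℓ X X′ → all X ℓ ≡ all X′ ℓ
all-local = cong and ∘ map-cong-local

sat-local : ∀ {X X′} r → AgreeOn (H r) X X′ → AgreeOn (B⁺ r) X X′ → AgreeOn (B⁻ r) X X′
          → sat X r ≡ sat X′ r
sat-local r h p n = cong₂ _∨_ (any-local h) (cong₂ _∨_ (cong not (all-local p)) (any-local n))

atomsRule : Rule → List Atom
atomsRule r = H r ++ B⁺ r ++ B⁻ r

atoms : Program → List Atom
atoms = concatMap atomsRule

ssRule-local : ∀ {X X′ Y Y′} r → AgreeOn (atomsRule r) X X′ → AgreeOn (atomsRule r) Y Y′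
             → ssRule X Y r ≡ ssRule X′ Y′ r
ssRule-local r x y with ++⁻ (H r) x | ++⁻ (H r) y
... | xH , xB | yH , yB with ++⁻ (B⁺ r) xB | ++⁻ (B⁺ r) yB
... | xP , xN | yP , _ =
  cong₂ _∨_ (cong not (sat-local r xH xP xN))
            (cong₂ _∨_ (any-local xN) (sat-local (positivePart r) yH yP All.[]))

ssModel-local : ∀ {X X′ Y Y′} P → AgreeOn (atoms P) X X′ → AgreeOn (atoms P) Y Y′
              → ssModel P X Y ≡ ssModel P X′ Y′
ssModel-local []      _ _ = refl
ssModel-local (r ∷ P) x y with ++⁻ (atomsRule r) x | ++⁻ (atomsRule r) y
... | xr , xP | yr , yP = cong₂ _∧_ (ssRule-local r xr yr) (ssModel-local P xP yP)

⊑-agree : ∀ {Y X} ℓ → Y ⊑ X → ¬ Any (λ c → X c ≡ true × Y c ≡ false) ℓ → AgreeOn ℓ Y X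
⊑-agree {Y} {X} ℓ Y⊑X no-gap = All.tabulate agree
  where
  agree : ∀ {c} → c ∈ ℓ → Y c ≡ X c
  agree {c} c∈ℓ with Y c in Yc
  ... | true = sym (Y⊑X c Yc)
  ... | false with X c in Xc
  ...   | false = refl
  ...   | true with () ← no-gap (lose c∈ℓ (Xc , Yc))

_↾_ : Interp → List Atom → Interp
(X ↾ L) c = does (c ∈? L) ∧ X c

↾-agree : ∀ X L → AgreeOn L (X ↾ L) X
↾-agree X L = All.tabulate λ {c} c∈L → cong (_∧ X c) (dec-true (c ∈? L) c∈L)

↾-support : ∀ X L c → (X ↾ L) c ≡ true → c ∈ L
↾-support X L c h with c ∈? L
... | yes c∈L = c∈L
... | no _ with () ← h

↾-mono : ∀ {Y X} L → Y ⊑ X → (Y ↾ L) ⊑ (X ↾ L)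
↾-mono L Y⊑X c h with c ∈? L
... | yes _ = Y⊑X c h
... | no _ with () ← h

-- Necessity of the characterisation

fact : Atom → Rule
fact y = rule (y ∷ []) [] []

_⇐_ : Atom → Atom → Rule
c ⇐ d = rule (c ∷ []) (d ∷ []) []

ssRule-fact : ∀ X Z y → X y ≡ true → ssRule X Z (fact y) ≡ Z y
ssRule-fact X Z y Xy rewrite Xy = trans (∨-identityʳ _) (∨-identityʳ (Z y))

ssRule-⇐ : ∀ X Z c d → X c ≡ true → ssRule X Z (c ⇐ d) ≡ (Z c ∨ not (Z d))
ssRule-⇐ X Z c d Xc rewrite Xc =
  cong₂ _∨_ (∨-identityʳ (Z c)) (trans (∨-identityʳ _) (cong not (∧-identityʳ (Z d))))

-- The facts of R force Y, and its rules c ← d make X ∖ Y all-or-nothing; so, on L,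
-- the only interpretation strictly below X₀ that satisfies the reduct of R is Y₀.
module Separation (L : List Atom) (X Y : Interp) (Y⊑X : Y ⊑ X) where

  X₀ Y₀ : Interp
  X₀ = X ↾ L
  Y₀ = Y ↾ L

  D : List Atom
  D = filterᵇ (λ c → X c ∧ not (Y c)) L

  R : Program
  R = map fact (filterᵇ Y L) ++ cartesianProductWith _⇐_ D D

  ∈D⁻ : ∀ {c} → c ∈ D → c ∈ L × X c ≡ true × Y c ≡ false
  ∈D⁻ c∈D with ∈-filterᵇ⁻ c∈D
  ... | c∈L , h = c∈L , ∧-not-elim h

  ∈D⁺ : ∀ {c} → c ∈ L → X c ≡ true → Y c ≡ false → c ∈ D
  ∈D⁺ c∈L Xc Yc = ∈-filterᵇ⁺ c∈L (cong₂ (λ x y → x ∧ not y) Xc Yc)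

  X₀≡X : ∀ {c} → c ∈ L → X₀ c ≡ X c
  X₀≡X = All.lookup (↾-agree X L)

  Y₀≡Y : ∀ {c} → c ∈ L → Y₀ c ≡ Y c
  Y₀≡Y = All.lookup (↾-agree Y L)

  ssModel-R-Y₀ : ssModel R X₀ Y₀ ≡ true
  ssModel-R-Y₀ = ∈-all {xs = R} holds
    where
    holds : ∀ {r} → r ∈ R → ssRule X₀ Y₀ r ≡ true
    holds r∈R with ∈-++⁻ (map fact (filterᵇ Y L)) r∈R
    ... | inj₁ r∈facts with ∈-map⁻ fact r∈facts
    ...   | y , y∈ , refl with ∈-filterᵇ⁻ y∈
    ...     | y∈L , Yy =
      trans (ssRule-fact X₀ Y₀ y (trans (X₀≡X y∈L) (Y⊑X y Yy))) (trans (Y₀≡Y y∈L) Yy)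
    holds r∈R | inj₂ r∈rules with ∈-cartesianProductWith⁻ _⇐_ D D r∈rules
    ... | c , d , c∈D , d∈D , refl with ∈D⁻ c∈D | ∈D⁻ d∈D
    ...   | c∈L , Xc , _ | d∈L , _ , Yd = begin
      ssRule X₀ Y₀ (c ⇐ d)   ≡⟨ ssRule-⇐ X₀ Y₀ c d (trans (X₀≡X c∈L) Xc) ⟩
      Y₀ c ∨ not (Y₀ d)      ≡⟨ cong (λ v → Y₀ c ∨ not v) (trans (Y₀≡Y d∈L) Yd) ⟩
      Y₀ c ∨ true            ≡⟨ ∨-zeroʳ _ ⟩
      true                   ∎

  ssModel-R⇒agree : ∀ Z → Z ⊂ X₀ → ssModel R X₀ Z ≡ true → AgreeOn L Z Y
  ssModel-R⇒agree Z (Z⊑X₀ , e , X₀e , Ze) R-holds = All.tabulate agree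
    where
    Y⊑Z : ∀ {y} → y ∈ L → Y y ≡ true → Z y ≡ true
    Y⊑Z {y} y∈L Yy = trans (sym (ssRule-fact X₀ Z y (trans (X₀≡X y∈L) (Y⊑X y Yy))))
                           (all-∈ R-holds (∈-++⁺ˡ (∈-map⁺ fact (∈-filterᵇ⁺ y∈L Yy))))

    D-closed : ∀ {c d} → c ∈ D → d ∈ D → Z d ≡ true → Z c ≡ true
    D-closed {c} {d} c∈D d∈D with ∈D⁻ c∈D
    ... | c∈L , Xc , _ = ∨-not-elim (trans (sym (ssRule-⇐ X₀ Z c d (trans (X₀≡X c∈L) Xc)))
      (all-∈ R-holds (∈-++⁺ʳ (map fact (filterᵇ Y L)) (∈-cartesianProductWith⁺ _⇐_ c∈D d∈D))))

    Z⇒X : ∀ {c} → c ∈ L → Z c ≡ true → X c ≡ true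
    Z⇒X {c} c∈L Zc = trans (sym (X₀≡X c∈L)) (Z⊑X₀ c Zc)

    e∈L : e ∈ L
    e∈L = ↾-support X L e X₀e

    e∈D : e ∈ D
    e∈D with Y e in Ye
    ... | false = ∈D⁺ e∈L (trans (sym (X₀≡X e∈L)) X₀e) Ye
    ... | true with () ← trans (sym (Y⊑Z e∈L Ye)) Ze

    agree : ∀ {c} → c ∈ L → Z c ≡ Y c
    agree {c} c∈L with Y c in Yc
    ... | true = Y⊑Z c∈L Yc
    ... | false with Z c in Zc
    ...   | false = refl
    ...   | true with () ← trans (sym (D-closed e∈D (∈D⁺ c∈L (Z⇒X c∈L Zc) Yc) Zc)) Ze

module _ (P Q : Program) (P≡Q : P ≡ss Q) (X Y : Interp) (Y⊑X : Y ⊑ X) where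
  private
    L : List Atom
    L = atoms P ++ atoms Q
    open Separation L X Y Y⊑X

    P-restriction : ssModel P X₀ Y₀ ≡ ssModel P X Y
    P-restriction = ssModel-local P (anti-mono ∈-++⁺ˡ (↾-agree X L)) (anti-mono ∈-++⁺ˡ (↾-agree Y L))

    Q-restriction : ∀ Z → AgreeOn L Z Y → ssModel Q X₀ Z ≡ ssModel Q X Y
    Q-restriction Z Z≈Y = ssModel-local Q (anti-mono (∈-++⁺ʳ (atoms P)) (↾-agree X L))
                                          (anti-mono (∈-++⁺ʳ (atoms P)) Z≈Y)

    Y₀≈X₀ : ¬ Any (λ c → X₀ c ≡ true × Y₀ c ≡ false) L → AgreeOn (atoms Q) Y₀ X₀
    Y₀≈X₀ no-gap = anti-mono (∈-++⁺ʳ (atoms P)) (⊑-agree L (↾-mono L Y⊑X) no-gap)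

    module _ (Q-false : ssModel Q X Y ≡ false) where
      Q∪R-stable : LPMLNStable (Q ++ R) X₀
      Q∪R-stable = Equivalence.from (LPMLNStable⇔minimal (Q ++ R) X₀) minimal
        where
        minimal : ∀ Z → Z ⊂ X₀ → ssModel (Q ++ R) X₀ Z ≡ false
        minimal Z Z⊂X₀ rewrite ssModel-++ Q R X₀ Z with ssModel R X₀ Z in R-holds
        ... | false = ∧-zeroʳ _
        ... | true  = cong (_∧ true) (trans (Q-restriction Z (ssModel-R⇒agree Z Z⊂X₀ R-holds)) Q-false)

      P∪R-minimal : ∀ Z → Z ⊂ X₀ → ssModel (P ++ R) X₀ Z ≡ false
      P∪R-minimal = Equivalence.to (LPMLNStable⇔minimal (P ++ R) X₀)
                                   (Equivalence.from (P≡Q R X₀) Q∪R-stable)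

  ≡ss⇒ssModel-false : ssModel Q X Y ≡ false → ssModel P X Y ≡ false
  ≡ss⇒ssModel-false Q-false with any? (λ c → (X₀ c ≟ᵇ true) ×-dec (Y₀ c ≟ᵇ false)) L
  ... | yes gap with satisfied gap
  ...   | c , X₀c , Y₀c = begin
    ssModel P X Y                      ≡⟨ P-restriction ⟨
    ssModel P X₀ Y₀                    ≡⟨ ∧-identityʳ _ ⟨
    ssModel P X₀ Y₀ ∧ true             ≡⟨ cong (ssModel P X₀ Y₀ ∧_) ssModel-R-Y₀ ⟨
    ssModel P X₀ Y₀ ∧ ssModel R X₀ Y₀  ≡⟨ ssModel-++ P R X₀ Y₀ ⟨
    ssModel (P ++ R) X₀ Y₀             ≡⟨ P∪R-minimal Q-false Y₀ (↾-mono L Y⊑X , c , X₀c , Y₀c) ⟩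
    false                              ∎
  ≡ss⇒ssModel-false Q-false | no no-gap with () ← begin
    true                               ≡⟨ ssModel-refl Q X₀ ⟨
    ssModel Q X₀ X₀                    ≡⟨ ssModel-local Q (All.tabulate λ _ → refl) (Y₀≈X₀ no-gap) ⟨
    ssModel Q X₀ Y₀                    ≡⟨ Q-restriction Y₀ (↾-agree Y L) ⟩
    ssModel Q X Y                      ≡⟨ Q-false ⟩
    false                              ∎

≡ss-refl : ∀ P → P ≡ss P
≡ss-refl P R X = ⇔-refl

≡ss-sym : ∀ P Q → P ≡ss Q → Q ≡ss P
≡ss-sym P Q P≡Q R X = ⇔-sym (P≡Q R X)

≡ss⇒SameSSModels : ∀ P Q → P ≡ss Q → SameSSModels P Q
≡ss⇒SameSSModels P Q P≡Q X Y Y⊑X = false-agreement⇒≡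
  (≡ss⇒ssModel-false Q P (≡ss-sym P Q P≡Q) X Y Y⊑X)
  (≡ss⇒ssModel-false P Q P≡Q X Y Y⊑X)

≢ss-witness : ∀ P Q X Y → Y ⊑ X → ssModel P X Y ≢ ssModel Q X Y → ¬ P ≡ss Q
≢ss-witness P Q X Y Y⊑X differ P≡Q = differ (≡ss⇒SameSSModels P Q P≡Q X Y Y⊑X)

-- Deleting an atom of a two-element independent set

replace : Atom → Atom → Atom → Atom
replace a b c with c ≟ a
... | yes _ = b
... | no  _ = c

replace-≢ : ∀ {a b c} → c ≢ a → replace a b c ≡ c
replace-≢ {a} {b} {c} c≢a with c ≟ a
... | yes c≡a = contradiction c≡a c≢a
... | no  _   = refl

deleteAtom : Atom → List Atom → List Atom
deleteAtom a = filterᵇ (λ c → not (c ≡ᵇ a))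

∈-deleteAtom⁻ : ∀ {a c ℓ} → c ∈ deleteAtom a ℓ → c ∈ ℓ × c ≢ a
∈-deleteAtom⁻ {a} {c} c∈ with ∈-filterᵇ⁻ c∈
... | c∈ℓ , c≢ᵇa = c∈ℓ , λ c≡a →
  contradiction (trans (sym (dec-true (c ≟ a) c≡a)) (not-injective {y = false} c≢ᵇa)) λ ()

∈-deleteAtom⁺ : ∀ {a c ℓ} → c ∈ ℓ → c ≢ a → c ∈ deleteAtom a ℓ
∈-deleteAtom⁺ {a} {c} c∈ℓ c≢a = ∈-filterᵇ⁺ c∈ℓ (cong not (dec-false (c ≟ a) c≢a))

Follows : Atom → Atom → List Atom → Set
Follows a b ℓ = a ∈ ℓ → b ∈ ℓ

deleteAtom⊆replace : ∀ a b ℓ → deleteAtom a ℓ ⊆ map (replace a b) ℓ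
deleteAtom⊆replace a b ℓ c∈ with ∈-deleteAtom⁻ c∈
... | c∈ℓ , c≢a = subst (_∈ map (replace a b) ℓ) (replace-≢ c≢a) (∈-map⁺ (replace a b) c∈ℓ)

replace⊆deleteAtom : ∀ {a b ℓ} → b ≢ a → Follows a b ℓ → map (replace a b) ℓ ⊆ deleteAtom a ℓ
replace⊆deleteAtom {a} {b} b≢a follows v∈ with ∈-map⁻ (replace a b) v∈
... | c , c∈ℓ , refl with c ≟ a
...   | yes refl = ∈-deleteAtom⁺ (follows c∈ℓ) b≢a
...   | no  c≢a  = ∈-deleteAtom⁺ c∈ℓ c≢a

module _ {a b : Atom} (b≢a : b ≢ a) where

  any-deleteAtom : ∀ X {ℓ} → Follows a b ℓ → any X (deleteAtom a ℓ) ≡ any (X ∘ replace a b) ℓ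
  any-deleteAtom X {ℓ} follows = trans
    (any-≋ (deleteAtom⊆replace a b ℓ) (replace⊆deleteAtom b≢a follows))
    (cong or (sym (map-∘ ℓ)))

  all-deleteAtom : ∀ X {ℓ} → Follows a b ℓ → all X (deleteAtom a ℓ) ≡ all (X ∘ replace a b) ℓ
  all-deleteAtom X {ℓ} follows = trans
    (all-≋ (deleteAtom⊆replace a b ℓ) (replace⊆deleteAtom b≢a follows))
    (cong and (sym (map-∘ ℓ)))

  sat-delRule : ∀ X r → Follows a b (H r) → Follows a b (B⁺ r) → Follows a b (B⁻ r)
              → sat X (delRule a r) ≡ sat (X ∘ replace a b) r
  sat-delRule X r fH fP fN = cong₂ _∨_ (any-deleteAtom X fH)
    (cong₂ _∨_ (cong not (all-deleteAtom X fP)) (any-deleteAtom X fN))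

  ssModel-delProg : ∀ X Y P → All (Follows a b) (sets P)
                  → ssModel (delProg a P) X Y ≡ ssModel P (X ∘ replace a b) (Y ∘ replace a b)
  ssModel-delProg X Y []      _ = refl
  ssModel-delProg X Y (r ∷ P) (fH All.∷ fP All.∷ fN All.∷ follows) = cong₂ _∧_
    (cong₂ _∨_ (cong not (sat-delRule X r fH fP fN))
               (cong₂ _∨_ (any-deleteAtom X fN) (sat-delRule Y (positivePart r) fH fP λ ())))
    (ssModel-delProg X Y P follows)

  ≡ss-delProg : ∀ P Q → All (Follows a b) (sets P) → All (Follows a b) (sets Q)
              → P ≡ss Q → delProg a P ≡ss delProg a Q
  ≡ss-delProg P Q fP fQ P≡Q = SameSSModels⇒≡ss (delProg a P) (delProg a Q) λ X Y Y⊑X → begin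
    ssModel (delProg a P) X Y   ≡⟨ ssModel-delProg X Y P fP ⟩
    ssModel P (X ∘ ρ) (Y ∘ ρ)   ≡⟨ ≡ss⇒SameSSModels P Q P≡Q (X ∘ ρ) (Y ∘ ρ) (Y⊑X ∘ ρ) ⟩
    ssModel Q (X ∘ ρ) (Y ∘ ρ)   ≡⟨ ssModel-delProg X Y Q fQ ⟨
    ssModel (delProg a Q) X Y   ∎
    where
    ρ : Atom → Atom
    ρ = replace a b

sets-++ : ∀ P Q → sets (P ++ Q) ≡ sets P ++ sets Q
sets-++ P Q = trans (cong concat (map-++ _ P Q)) (sym (concat-++ (map _ P) (map _ Q)))

independent-Follows : ∀ T {N′ a b} → InIndep T N′ a → InIndep T N′ b → All (Follows a b) (sets T)
independent-Follows T {N′} a∈I b∈I = All.tabulate λ {ℓ} ℓ∈sets a∈ℓ →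
  let i = index ℓ∈sets ; ℓ≡Sᵢ = lookup-index ℓ∈sets in
  case i ∈ₛ? N′ of λ where
    (yes i∈N′) → subst (_ ∈_) (sym ℓ≡Sᵢ) (proj₁ (b∈I i) i∈N′)
    (no  i∉N′) → contradiction (subst (_ ∈_) ℓ≡Sᵢ a∈ℓ) (proj₂ (a∈I i) i∉N′)

partner : ∀ {x y a : Atom} → x ≢ y → a ∈ x ∷ y ∷ [] → ∃[ b ] b ≢ a × b ∈ x ∷ y ∷ []
partner x≢y (here refl)         = _ , ≢-sym x≢y , there (here refl)
partner x≢y (there (here refl)) = _ , x≢y , here refl

SRD2-SE-preserving : SEPreserving-SRD 2
SRD2-SE-preserving P Q a (_ , _ , a∈I , (_ ∷ _ ∷ [] , (x≢y All.∷ _) AllPairs.∷ _ , I⇔xs , refl)) P≡Q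
  with partner x≢y (Equivalence.to (I⇔xs a) a∈I)
... | b , b≢a , b∈xs with ++⁻ (sets P) (subst (All (Follows a b)) (sets-++ P Q)
                            (independent-Follows (P ++ Q) a∈I (Equivalence.from (I⇔xs b) b∈xs)))
...   | fP , fQ = ≡ss-delProg b≢a P Q fP fQ P≡Q

-- Counterexamples

inIndep? : ∀ T N′ a → Dec (InIndep T N′ a)
inIndep? T N′ a = Fin.all? λ i →
  ((i ∈ₛ? N′) →-dec (a ∈? lookup (sets T) i))
  ×-dec (¬? (i ∈ₛ? N′) →-dec ¬? (a ∈? lookup (sets T) i))

-- The independent set is the i-th set S of the tuple; i ∈ N′ gives I_N′ ⊆ S.
admissible : ∀ P Q a N′ i → let T = P ++ Q ; S = lookup (sets T) i in
             True (i ∈ₛ? N′) → True (inIndep? T N′ a) → True (unique? S)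
           → True (All.all? (inIndep? T N′) S) → AdmissibleSRD (length S) P Q a
admissible P Q a N′ i i∈N′ a∈I S-unique S⊆I =
  N′ , (i , toWitness i∈N′) , toWitness a∈I , _ , toWitness S-unique ,
  (λ c → mk⇔ (λ c∈I → proj₁ (c∈I i) (toWitness i∈N′)) (All.lookup (toWitness S⊆I))) , refl

⟦_⟧ : List Atom → Interp
⟦ ℓ ⟧ c = does (c ∈? ℓ)

P₁ : Program
P₁ = rule (0 ∷ 1 ∷ []) (1 ∷ []) [] ∷ []

P₁-admissible : AdmissibleSRD 1 P₁ [] 1
P₁-admissible = admissible P₁ [] 1 (⁅ # 0 ⁆ ∪ ⁅ # 1 ⁆) (# 1) _ _ _ _

P₁≡ss[] : P₁ ≡ss []
P₁≡ss[] = SameSSModels⇒≡ss P₁ [] λ X Y _ →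
  trans (∧-identityʳ _)
        (ssRule-tautology X Y (rule (0 ∷ 1 ∷ []) (1 ∷ []) []) (there (here refl)) (here refl))

¬SRD1-SE-preserving : ¬ SEPreserving-SRD 1
¬SRD1-SE-preserving SE = ≢ss-witness (delProg 1 P₁) [] ⟦ 0 ∷ [] ⟧ ⟦ [] ⟧ (λ _ ()) (λ ())
  (SE P₁ [] 1 P₁-admissible P₁≡ss[])

P₂ Q₂ : Program
P₂ = fact 0 ∷ []
Q₂ = (0 ⇐ 1) ∷ []

P₂Q₂-admissible : AdmissibleSRD 1 P₂ Q₂ 1
P₂Q₂-admissible = admissible P₂ Q₂ 1 ⁅ # 4 ⁆ (# 4) _ _ _ _

¬SRD1-NSE-preserving : ¬ NSEPreserving-SRD 1
¬SRD1-NSE-preserving NSE = NSE P₂ Q₂ 1 P₂Q₂-admissible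
  (≢ss-witness P₂ Q₂ ⟦ 0 ∷ [] ⟧ ⟦ [] ⟧ (λ _ ()) (λ ())) (≡ss-refl (delProg 1 P₂))

P₃ Q₃ : Program
P₃ = fact 2 ∷ rule (0 ∷ 1 ∷ 2 ∷ []) [] [] ∷ []
Q₃ = rule (2 ∷ []) (0 ∷ 1 ∷ []) [] ∷ rule (0 ∷ 1 ∷ 2 ∷ []) [] [] ∷ []

P₃Q₃-admissible : AdmissibleSRD 2 P₃ Q₃ 0
P₃Q₃-admissible = admissible P₃ Q₃ 0 (⁅ # 3 ⁆ ∪ ⁅ # 7 ⁆ ∪ ⁅ # 9 ⁆) (# 7) _ _ _ _

delProg0-P₃≡ss-Q₃ : delProg 0 P₃ ≡ss delProg 0 Q₃
delProg0-P₃≡ss-Q₃ = SameSSModels⇒≡ss (delProg 0 P₃) (delProg 0 Q₃) truth-table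
  where
  truth-table : SameSSModels (delProg 0 P₃) (delProg 0 Q₃)
  truth-table X Y Y⊑X with X 1 | X 2 | Y 1 | Y 2 | Y⊑X 1
  ... | true  | true  | true  | true  | _ = refl
  ... | true  | true  | true  | false | _ = refl
  ... | true  | true  | false | true  | _ = refl
  ... | true  | true  | false | false | _ = refl
  ... | true  | false | true  | true  | _ = refl
  ... | true  | false | true  | false | _ = refl
  ... | true  | false | false | true  | _ = refl
  ... | true  | false | false | false | _ = refl
  ... | false | true  | true  | true  | _ = refl
  ... | false | true  | true  | false | _ = refl
  ... | false | true  | false | true  | _ = refl
  ... | false | true  | false | false | _ = refl
  ... | false | false | true  | _     | Y₁⇒X₁ with () ← Y₁⇒X₁ refl
  ... | false | false | false | true  | _ = refl
  ... | false | false | false | false | _ = refl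

¬SRD2-NSE-preserving : ¬ NSEPreserving-SRD 2
¬SRD2-NSE-preserving NSE = NSE P₃ Q₃ 0 P₃Q₃-admissible
  (≢ss-witness P₃ Q₃ ⟦ 0 ∷ 2 ∷ [] ⟧ ⟦ 0 ∷ [] ⟧ (λ { 0 _ → refl ; (suc _) () }) (λ ()))
  delProg0-P₃≡ss-Q₃

theorem4 : (¬ SEPreserving-SRD 1 × ¬ NSEPreserving-SRD 1)
         × (SEPreserving-SRD 2 × ¬ NSEPreserving-SRD 2)
theorem4 = (¬SRD1-SE-preserving , ¬SRD1-NSE-preserving) , (SRD2-SE-preserving , ¬SRD2-NSE-preserving)
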